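{- Consider the generalized Sudoku problem with data $n, \pi_1, \pi_2, \pi_3, i_1, \ldots, i_k, g_{i_1}, \ldots, g_{i_k}$. Let $i \in \{1, \ldots, n^2\}$ be a cell and let $v \in \{1, \ldots, n\}$. The following are equivalent: (i) the cell $i$ is a unicity cell with unique value $v$; (ii) there exists a base set $J \subset \{1, \ldots, n^2\}$ with $i \in J$ such that $i$ is a unicity cell w.r.t. the base set $J$ with unique value $v$.
   Context: For $y \in \mathbb{Z}^s$ write $y <> \mathbf{0}$ if every component of $y$ is nonzero. Let $n \ge 2$ and $s(n) = \sum_{i=1}^{n-1} i$. The $s(n) \times n$ matrix $A(n)$ is defined inductively: $A(1)$ is the empty matrix, and $A(m) = \begin{pmatrix} \mathbf{1}_{m-1} & -U_{m-1} \\ \mathbf{0}_{s(m-1)} & A(m-1) \end{pmatrix}$, where $\mathbf{1}_{m-1}$ is the all-ones column, $U_{m-1}$ the identity matrix and $\mathbf{0}_{s(m-1)}$ the zero column of length $s(m-1)$. Let $A$ be the $(n \cdot s(n)) \times n^2$ block-diagonal matrix whose $n$ diagonal blocks all equal $A(n)$. For a permutation $\pi$ of $\{1,\ldots,n^2\}$, $A_\pi$ is the matrix whose $j$-th column is the $\pi^{ -1}(j)$-th column of $A$. Elements of $\{1,\ldots,n^2\}$ are called cells. Generalized Sudoku problem: given permutations $\pi_1, \pi_2, \pi_3$ of $\{1, \ldots, n^2\}$, an integer $0 \le k \le n^2$, an index set $\{i_1, \ldots, i_k\} \subset \{1, \ldots, n^2\}$ and givens $g_{i_l} \in \mathbb{Z}$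 with $1 \le g_{i_l} \le n$, find $x \in \mathbb{Z}^{n^2}$ with $1 \le x_i \le n$ for all $i$, $A_{\pi_r}x <> \mathbf{0}$ for $r = 1,2,3$ and $x_{i_l} = g_{i_l}$ for $l = 1, \ldots, k$. Write the last conditions as $A_{eq}x = g$, where $A_{eq}$ is the $k \times n^2$ matrix whose $l$-th row is the $i_l$-th unit row vector and $g = (g_{i_1}, \ldots, g_{i_k})^T$. Reduced problem: for a base set $J = \{j_1, \ldots, j_p\} \subset \{1,\ldots,n^2\}$ with $1 \le p \le n^2$ and $j_1 < \cdots < j_p$, let $P_J(x) = (x_{j_1}, \ldots, x_{j_p})^T$ and $t_J(j_l) = l$. For a matrix $M$ with $n^2$ columns, $P_J(M)$ keeps the columns $j_1, \ldots, j_p$. Let $B_r$ ($r = 1,2,3$) be obtained from $P_J(A_{\pi_r})$ by deleting all rows with at most one nonzero entry, let $B_{eq}$ be obtained from $P_J(A_{eq})$ by deleting all zero rows, and let $g'$ be obtained from $g$ by deleting the components corresponding to deleted rows of $P_J(A_{eq})$. The reduced problem induced by $J$ is: find $z \in \mathbb{Z}^p$ with $1 \le z_i \le n$ for all $i$, $B_r z <> \mathbf{0}$ for $r = 1,2,3$, and $B_{eq} z = g'$. A cell $i$ is a unicity cell with unique value $v \in \{1,\ldots,n\}$ if every solution $x$ of the generalized Sudoku problem satisfies $x_i = v$. For $i \in J$, the cell $i$ is a unicity cell w.r.t. the base set $J$ with unique value $v$ if every solution $z$ of the reduced problem induced by $J$ satisfies $z_{t_J(i)} = v$. (Solvability is not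 required in either definition.) -}

module Defs where

open import Data.Nat as ℕ using (ℕ; zero; suc)
open import Data.Integer as ℤ using (ℤ; +_; _+_; _*_; -_; _≤_)
open import Data.Fin as Fin using (Fin; zero; suc; _<_; remQuot; quotient; remainder)
open import Data.Fin.Permutation using (Permutation′; _⟨$⟩ˡ_)
open import Data.List as List using (List; []; _∷_; _++_; map; foldr; allFin; filter; tabulate)
open import Data.List.Relation.Unary.All using (All)
import Data.Nat.ListAction as ListAction
open import Data.Product using (_×_; _,_; proj₁; proj₂)
open import Data.Bool using (if_then_else_)
open import Relation.Nullary using (¬_; does)
open import Relation.Binary.PropositionalEquality using (_≡_; _≢_)
open import Function.Definitions using (Injective)

-- A matrix with c columns, given as the list of its rows
-- (a row is a function  Fin c → ℤ).  Cells / columns are 0-indexed.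
Matrix : ℕ → Set
Matrix c = List (Fin c → ℤ)

Σ : ∀ {c} → (Fin c → ℤ) → ℤ
Σ {c} f = foldr _+_ (+ 0) (map f (allFin c))

_·_ : ∀ {c} → Matrix c → (Fin c → ℤ) → List ℤ
M · x = map (λ r → Σ (λ j → r j * x j)) M

NonZeroAll : List ℤ → Set
NonZeroAll y = All (λ a → a ≢ + 0) y

nnz : ∀ {c} → (Fin c → ℤ) → ℕ
nnz {c} r = ListAction.sum (map (λ j → if does (r j ℤ.≟ + 0) then 0 else 1) (allFin c))

s : ℕ → ℕ
s zero = 0
s (suc m) = m ℕ.+ s m

-- A(m), defined inductively as in the paper (A(0) is also taken empty;
-- it is only used through A(1) = empty).
-- The first m rows of A(m+1) form (1_m | -U_m); the rest are (0 | A(m)).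
Amat : (m : ℕ) → Matrix m
Amat zero = []
Amat (suc m) =
  tabulate (λ (j : Fin m) → λ { zero → + 1
                               ; (suc k) → if does (k Fin.≟ j) then - (+ 1) else + 0 })
  ++ map (λ r → λ { zero → + 0 ; (suc k) → r k }) (Amat m)

-- The block-diagonal matrix A with n diagonal blocks A(n); column c of
-- Fin (n*n) lies in block  quotient n c  at inner position  remainder n c.
Ablock : (n : ℕ) → Matrix (n ℕ.* n)
Ablock n = List.concatMap
  (λ (b : Fin n) → map (λ r → λ (c : Fin (n ℕ.* n)) →
       if does (quotient n c Fin.≟ b) then r (remainder {n} n c) else + 0) (Amat n))
  (allFin n)

-- A_π : its j-th column is the π⁻¹(j)-th column of A
Aπ : (n : ℕ) → Permutation′ (n ℕ.* n) → Matrix (n ℕ.* n)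
Aπ n π = map (λ r j → r (π ⟨$⟩ˡ j)) (Ablock n)

unit : ∀ {c} → Fin c → (Fin c → ℤ)
unit i j = if does (j Fin.≟ i) then + 1 else + 0

AeqG : ∀ {N k} → (Fin k → Fin N) → (Fin k → ℤ) → List ((Fin N → ℤ) × ℤ)
AeqG idx g = tabulate (λ l → unit (idx l) , g l)

InRange : ∀ {c} → ℕ → (Fin c → ℤ) → Set
InRange {c} n x = ∀ i → + 1 ≤ x i × x i ≤ + n

IsSolution : (n : ℕ) (π₁ π₂ π₃ : Permutation′ (n ℕ.* n)) (k : ℕ)
             (idx : Fin k → Fin (n ℕ.* n)) (g : Fin k → ℤ) →
             (Fin (n ℕ.* n) → ℤ) → Set
IsSolution n π₁ π₂ π₃ k idx g x =
  InRange n x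
  × NonZeroAll (Aπ n π₁ · x)
  × NonZeroAll (Aπ n π₂ · x)
  × NonZeroAll (Aπ n π₃ · x)
  × map proj₁ (AeqG idx g) · x ≡ map proj₂ (AeqG idx g)

PJ : ∀ {N p} → (Fin p → Fin N) → (Fin N → ℤ) → (Fin p → ℤ)
PJ J r l = r (J l)

Bmat : ∀ {N p} → (Fin p → Fin N) → Matrix N → Matrix p
Bmat J M = filter (λ r → 2 ℕ.≤? nnz r) (map (PJ J) M)

BeqG : ∀ {N p} → (Fin p → Fin N) → List ((Fin N → ℤ) × ℤ) → List ((Fin p → ℤ) × ℤ)
BeqG J rows = filter (λ rg → 1 ℕ.≤? nnz (proj₁ rg))
                     (map (λ rg → PJ J (proj₁ rg) , proj₂ rg) rows)

-- Solutions of the reduced problem induced by the base set J = {J 0 < ... < J (p-1)}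
IsReducedSolution : (n : ℕ) (π₁ π₂ π₃ : Permutation′ (n ℕ.* n)) (k : ℕ)
                    (idx : Fin k → Fin (n ℕ.* n)) (g : Fin k → ℤ)
                    (p : ℕ) (J : Fin p → Fin (n ℕ.* n)) → (Fin p → ℤ) → Set
IsReducedSolution n π₁ π₂ π₃ k idx g p J z =
  InRange n z
  × NonZeroAll (Bmat J (Aπ n π₁) · z)
  × NonZeroAll (Bmat J (Aπ n π₂) · z)
  × NonZeroAll (Bmat J (Aπ n π₃) · z)
  × map proj₁ (BeqG J (AeqG idx g)) · z ≡ map proj₂ (BeqG J (AeqG idx g))

StrictlyIncreasing : ∀ {p N} → (Fin p → Fin N) → Set
StrictlyIncreasing J = ∀ a b → a < b → J a < J b

UnicityCell : (n : ℕ) (π₁ π₂ π₃ : Permutation′ (n ℕ.* n)) (k : ℕ)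
              (idx : Fin k → Fin (n ℕ.* n)) (g : Fin k → ℤ)
              (i : Fin (n ℕ.* n)) (v : ℤ) → Set
UnicityCell n π₁ π₂ π₃ k idx g i v =
  ∀ x → IsSolution n π₁ π₂ π₃ k idx g x → x i ≡ v

-- cell i = J l (so t_J(i) = l) is a unicity cell w.r.t. J with unique value v
UnicityCellWrt : (n : ℕ) (π₁ π₂ π₃ : Permutation′ (n ℕ.* n)) (k : ℕ)
                 (idx : Fin k → Fin (n ℕ.* n)) (g : Fin k → ℤ)
                 (p : ℕ) (J : Fin p → Fin (n ℕ.* n)) (l : Fin p) (v : ℤ) → Set
UnicityCellWrt n π₁ π₂ π₃ k idx g p J l v =
  ∀ z → IsReducedSolution n π₁ π₂ π₃ k idx g p J z → z l ≡ v

module Submission where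

-- The key structural fact is that every row of a Sudoku constraint matrix
-- A_π has exactly two nonzero entries, and every row of A_eq exactly one.
--
-- (i) ⇒ (ii): take J to be all cells.  Restricting to all columns deletes
-- no row (each row has a nonzero entry, at least two for the rows of A_π),
-- so the reduced problem is the original one.
--
-- (ii) ⇒ (i): if x solves the original problem, then z = x ∘ J solves the
-- reduced one.  A row r surviving the reduction keeps all its nonzero
-- columns inside J (it keeps at least as many as r has), hence the
-- restricted row sees the same dot product: (r ∘ J) · (x ∘ J) = r · x.

open import Defs
open import Data.Nat as ℕ using (ℕ; zero; suc; _≤_; z≤n; s≤s)
import Data.Nat.Properties as ℕP
open import Data.Integer as ℤ using (ℤ; +_; _*_)
import Data.Integer.Properties as ℤP
open import Data.Fin as Fin using (Fin; zero; suc)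
import Data.Fin.Properties as FinP
open import Data.Fin.Permutation using (Permutation′; _⟨$⟩ˡ_; _⟨$⟩ʳ_; inverseˡ; inverseʳ)
open import Data.List as List using (List; []; _∷_)
import Data.List.Properties as ListP
open import Data.List.Relation.Unary.All as All using (All; []; _∷_)
import Data.List.Relation.Unary.All.Properties as AllP
open import Data.Vec.Functional as Vector using (Vector)
open import Data.Product using (_×_; _,_; proj₁; proj₂; ∃; Σ-syntax)
open import Data.Bool using (if_then_else_)
open import Data.Empty using (⊥-elim)
open import Data.Sum using (_⊎_; inj₁; inj₂)
open import Algebra.Bundles using (CommutativeMonoid)
open import Function using (_∘_; id)
open import Function.Bundles using (_⇔_; mk⇔)
open import Function.Definitions using (Injective)
open import Relation.Binary using (tri<; tri≈; tri>)
open import Relation.Binary.PropositionalEquality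
  using (_≡_; _≢_; refl; sym; trans; cong; cong₂; subst; module ≡-Reasoning)
open import Relation.Nullary using (does; yes; no; ¬?)
open import Relation.Unary using (Pred; Decidable)
open import Level using (0ℓ)

-- The sums of Defs (folds over the list of all indices) are the usual
-- finite sums of vectors; this lets us use the library's summation lemmas.
foldr-tabulate : ∀ {A : Set} (_⊕_ : A → A → A) (e : A) {c} (f : Fin c → A) →
                 List.foldr _⊕_ e (List.tabulate f) ≡ Vector.foldr _⊕_ e f
foldr-tabulate _⊕_ e {zero}  f = refl
foldr-tabulate _⊕_ e {suc c} f = cong (f zero ⊕_) (foldr-tabulate _⊕_ e (f ∘ suc))

foldr-allFin : ∀ {A : Set} (_⊕_ : A → A → A) (e : A) {c} (f : Fin c → A) →
               List.foldr _⊕_ e (List.map f (List.allFin c)) ≡ Vector.foldr _⊕_ e f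
foldr-allFin _⊕_ e f =
  trans (cong (List.foldr _⊕_ e) (ListP.map-tabulate id f)) (foldr-tabulate _⊕_ e f)

module SupportedSums {c ℓ} (M : CommutativeMonoid c ℓ) where
  open CommutativeMonoid M
    using (Carrier; _≈_; setoid; identityˡ; identityʳ; comm)
    renaming ( _∙_ to _+_; ε to 0#; ∙-cong to +-cong; ∙-congˡ to +-congˡ
             ; refl to ≈-refl; trans to ≈-trans)
  open import Algebra.Properties.CommutativeMonoid.Sum M using (sum) public
  open import Relation.Binary.Reasoning.Setoid setoid

  sum-zero : ∀ {n} (f : Vector Carrier n) → (∀ j → f j ≈ 0#) → sum f ≈ 0#
  sum-zero {zero}  f _      = ≈-refl
  sum-zero {suc n} f vanish =
    ≈-trans (+-cong (vanish zero) (sum-zero (f ∘ suc) (vanish ∘ suc))) (identityʳ 0#)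

  sum-single : ∀ {n} (f : Vector Carrier n) (a : Fin n) → (∀ j → j ≢ a → f j ≈ 0#) → sum f ≈ f a
  sum-single f zero    vanish = begin
    f zero + sum (f ∘ suc) ≈⟨ +-congˡ (sum-zero (f ∘ suc) (λ j → vanish (suc j) λ ())) ⟩
    f zero + 0#            ≈⟨ identityʳ (f zero) ⟩
    f zero                 ∎
  sum-single f (suc a) vanish = begin
    f zero + sum (f ∘ suc) ≈⟨ +-cong (vanish zero λ ()) (sum-single (f ∘ suc) a vanish-tail) ⟩
    0# + f (suc a)         ≈⟨ identityˡ (f (suc a)) ⟩
    f (suc a)              ∎
    where
    vanish-tail : ∀ j → j ≢ a → f (suc j) ≈ 0#
    vanish-tail j j≢a = vanish (suc j) (j≢a ∘ FinP.suc-injective)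

  sum-pair : ∀ {n} (f : Vector Carrier n) (a b : Fin n) → a ≢ b →
             (∀ j → j ≢ a → j ≢ b → f j ≈ 0#) → sum f ≈ f a + f b
  sum-pair f zero    zero    a≢b _ = ⊥-elim (a≢b refl)
  sum-pair f zero    (suc b) _   vanish =
    +-congˡ (sum-single (f ∘ suc) b (λ j j≢b → vanish (suc j) (λ ()) (j≢b ∘ FinP.suc-injective)))
  sum-pair f (suc a) zero    _   vanish = begin
    f zero + sum (f ∘ suc) ≈⟨ +-congˡ (sum-single (f ∘ suc) a vanish-tail) ⟩
    f zero + f (suc a)     ≈⟨ comm (f zero) (f (suc a)) ⟩
    f (suc a) + f zero     ∎
    where
    vanish-tail : ∀ j → j ≢ a → f (suc j) ≈ 0#
    vanish-tail j j≢a = vanish (suc j) (j≢a ∘ FinP.suc-injective) (λ ())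
  sum-pair f (suc a) (suc b) a≢b vanish = begin
    f zero + sum (f ∘ suc)       ≈⟨ +-cong (vanish zero (λ ()) (λ ())) (sum-pair (f ∘ suc) a b a≢b′ vanish-tail) ⟩
    0# + (f (suc a) + f (suc b)) ≈⟨ identityˡ _ ⟩
    f (suc a) + f (suc b)        ∎
    where
    a≢b′ : a ≢ b
    a≢b′ = a≢b ∘ cong suc
    vanish-tail : ∀ j → j ≢ a → j ≢ b → f (suc j) ≈ 0#
    vanish-tail j j≢a j≢b = vanish (suc j) (j≢a ∘ FinP.suc-injective) (j≢b ∘ FinP.suc-injective)

  sum-restrict-single : ∀ {m n} (J : Fin m → Fin n) → Injective _≡_ _≡_ J →
    (f : Vector Carrier n) (a : Fin m) → (∀ j → j ≢ J a → f j ≈ 0#) → sum (f ∘ J) ≈ sum f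
  sum-restrict-single J J-inj f a vanish = begin
    sum (f ∘ J) ≈⟨ sum-single (f ∘ J) a (λ j j≢a → vanish (J j) (j≢a ∘ J-inj)) ⟩
    f (J a)     ≈⟨ sum-single f (J a) vanish ⟨
    sum f       ∎

  sum-restrict-pair : ∀ {m n} (J : Fin m → Fin n) → Injective _≡_ _≡_ J →
    (f : Vector Carrier n) (a b : Fin m) → a ≢ b →
    (∀ j → j ≢ J a → j ≢ J b → f j ≈ 0#) → sum (f ∘ J) ≈ sum f
  sum-restrict-pair J J-inj f a b a≢b vanish = begin
    sum (f ∘ J)       ≈⟨ sum-pair (f ∘ J) a b a≢b (λ j j≢a j≢b → vanish (J j) (j≢a ∘ J-inj) (j≢b ∘ J-inj)) ⟩
    f (J a) + f (J b) ≈⟨ sum-pair f (J a) (J b) (a≢b ∘ J-inj) vanish ⟨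
    sum f             ∎

module ℤSum = SupportedSums ℤP.+-0-commutativeMonoid
module ℕSum = SupportedSums ℕP.+-0-commutativeMonoid

term≤sum : ∀ {n} (f : Vector ℕ n) (a : Fin n) → f a ≤ ℕSum.sum f
term≤sum f zero    = ℕP.m≤m+n (f zero) _
term≤sum f (suc a) = ℕP.≤-trans (term≤sum (f ∘ suc) a) (ℕP.m≤n+m _ (f zero))

pair≤sum : ∀ {n} (f : Vector ℕ n) (a b : Fin n) → a ≢ b → f a ℕ.+ f b ≤ ℕSum.sum f
pair≤sum f zero    zero    a≢b = ⊥-elim (a≢b refl)
pair≤sum f zero    (suc b) _   = ℕP.+-monoʳ-≤ (f zero) (term≤sum (f ∘ suc) b)
pair≤sum f (suc a) zero    _   = subst (_≤ ℕSum.sum f) (ℕP.+-comm (f zero) (f (suc a)))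
                                       (ℕP.+-monoʳ-≤ (f zero) (term≤sum (f ∘ suc) a))
pair≤sum f (suc a) (suc b) a≢b =
  ℕP.≤-trans (pair≤sum (f ∘ suc) a b (a≢b ∘ cong suc)) (ℕP.m≤n+m _ (f zero))

isNonzero : ℤ → ℕ
isNonzero a = if does (a ℤ.≟ + 0) then 0 else 1

isNonzero-≢0 : ∀ {a} → a ≢ + 0 → isNonzero a ≡ 1
isNonzero-≢0 {a} a≢0 with a ℤ.≟ + 0
... | yes a≡0 = ⊥-elim (a≢0 a≡0)
... | no  _   = refl

isNonzero-≡0 : ∀ {a} → a ≡ + 0 → isNonzero a ≡ 0
isNonzero-≡0 refl = refl

isNonzero≤1 : ∀ a → isNonzero a ≤ 1
isNonzero≤1 a with a ℤ.≟ + 0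
... | yes _ = z≤n
... | no  _ = s≤s z≤n

nnz≡sum : ∀ {c} (r : Fin c → ℤ) → nnz r ≡ ℕSum.sum (isNonzero ∘ r)
nnz≡sum r = foldr-allFin ℕ._+_ 0 (isNonzero ∘ r)

nonzero-or-nnz≡0 : ∀ {c} (r : Fin c → ℤ) → (∃ λ j → r j ≢ + 0) ⊎ nnz r ≡ 0
nonzero-or-nnz≡0 r with FinP.any? (λ j → ¬? (r j ℤ.≟ + 0))
... | yes nonzero = inj₁ nonzero
... | no  allZero = inj₂ (trans (nnz≡sum r) (ℕSum.sum-zero _ (λ j → isNonzero-≡0 (zero-at j))))
  where
  zero-at : ∀ j → r j ≡ + 0
  zero-at j with r j ℤ.≟ + 0
  ... | yes r≡0 = r≡0
  ... | no  r≢0 = ⊥-elim (allZero (j , r≢0))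

1≤nnz : ∀ {c} (r : Fin c → ℤ) (a : Fin c) → r a ≢ + 0 → 1 ≤ nnz r
1≤nnz r a ra≢0 rewrite nnz≡sum r =
  subst (_≤ ℕSum.sum (isNonzero ∘ r)) (isNonzero-≢0 ra≢0) (term≤sum (isNonzero ∘ r) a)

2≤nnz : ∀ {c} (r : Fin c → ℤ) (a b : Fin c) → a ≢ b → r a ≢ + 0 → r b ≢ + 0 → 2 ≤ nnz r
2≤nnz r a b a≢b ra≢0 rb≢0 rewrite nnz≡sum r =
  subst (_≤ ℕSum.sum (isNonzero ∘ r)) (cong₂ ℕ._+_ (isNonzero-≢0 ra≢0) (isNonzero-≢0 rb≢0))
        (pair≤sum (isNonzero ∘ r) a b a≢b)

1≤nnz⇒nonzero : ∀ {c} (r : Fin c → ℤ) → 1 ≤ nnz r → ∃ λ j → r j ≢ + 0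
1≤nnz⇒nonzero r 1≤nnz with nonzero-or-nnz≡0 r
... | inj₁ nonzero = nonzero
... | inj₂ nnz≡0   = ⊥-elim (ℕP.<⇒≢ 1≤nnz (sym nnz≡0))

nnz≤1 : ∀ {c} (r : Fin c → ℤ) → (∀ l m → r l ≢ + 0 → r m ≢ + 0 → l ≡ m) → nnz r ≤ 1
nnz≤1 r unique with nonzero-or-nnz≡0 r
... | inj₂ nnz≡0 = ℕP.≤-trans (ℕP.≤-reflexive nnz≡0) z≤n
... | inj₁ (l , rl≢0) = ℕP.≤-trans (ℕP.≤-reflexive (trans (nnz≡sum r) (ℕSum.sum-single _ l vanish)))
                                   (isNonzero≤1 (r l))
  where
  vanish : ∀ j → j ≢ l → isNonzero (r j) ≡ 0
  vanish j j≢l with r j ℤ.≟ + 0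
  ... | yes _   = refl
  ... | no  rj≢0 = ⊥-elim (j≢l (unique j l rj≢0 rl≢0))

dot : ∀ {c} → (Fin c → ℤ) → (Fin c → ℤ) → ℤ
dot r x = Σ (λ j → r j * x j)

dot≡sum : ∀ {c} (r x : Fin c → ℤ) → dot r x ≡ ℤSum.sum (λ j → r j * x j)
dot≡sum r x = foldr-allFin ℤ._+_ (+ 0) (λ j → r j * x j)

record PairSupport {N : ℕ} (r : Fin N → ℤ) : Set where
  field
    col₁ col₂ : Fin N
    distinct  : col₁ ≢ col₂
    nonzero₁  : r col₁ ≢ + 0
    nonzero₂  : r col₂ ≢ + 0
    vanish    : ∀ c → c ≢ col₁ → c ≢ col₂ → r c ≡ + 0

open PairSupport

pairSupport-cong : ∀ {N} {r r′ : Fin N → ℤ} → (∀ c → r c ≡ r′ c) → PairSupport r → PairSupport r′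
pairSupport-cong r≗r′ ps = record
  { col₁ = col₁ ps ; col₂ = col₂ ps ; distinct = distinct ps
  ; nonzero₁ = nonzero₁ ps ∘ trans (r≗r′ (col₁ ps))
  ; nonzero₂ = nonzero₂ ps ∘ trans (r≗r′ (col₂ ps))
  ; vanish = λ c c≢₁ c≢₂ → trans (sym (r≗r′ c)) (vanish ps c c≢₁ c≢₂) }

-- Such a row survives any deletion of rows with at most one nonzero entry.
2≤nnz-pair : ∀ {N} {r : Fin N → ℤ} → PairSupport r → 2 ≤ nnz r
2≤nnz-pair {r = r} ps = 2≤nnz r (col₁ ps) (col₂ ps) (distinct ps) (nonzero₁ ps) (nonzero₂ ps)

unit-self : ∀ {c} (i : Fin c) → unit i i ≢ + 0
unit-self i with i Fin.≟ i
... | yes _   = λ ()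
... | no  i≢i = ⊥-elim (i≢i refl)

unit-vanish : ∀ {c} (i j : Fin c) → j ≢ i → unit i j ≡ + 0
unit-vanish i j j≢i with j Fin.≟ i
... | yes j≡i = ⊥-elim (j≢i j≡i)
... | no  _   = refl

unit-nonzero : ∀ {c} (i j : Fin c) → unit i j ≢ + 0 → j ≡ i
unit-nonzero i j uij≢0 with j Fin.≟ i
... | yes j≡i = j≡i
... | no  _   = ⊥-elim (uij≢0 refl)

equations⇒All : ∀ {c} (L : List ((Fin c → ℤ) × ℤ)) (z : Fin c → ℤ) →
                List.map proj₁ L · z ≡ List.map proj₂ L → All (λ rv → dot (proj₁ rv) z ≡ proj₂ rv) L
equations⇒All []       z _   = []
equations⇒All (_ ∷ L) z eqs = ListP.∷-injectiveˡ eqs ∷ equations⇒All L z (ListP.∷-injectiveʳ eqs)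

All⇒equations : ∀ {c} (L : List ((Fin c → ℤ) × ℤ)) (z : Fin c → ℤ) →
                All (λ rv → dot (proj₁ rv) z ≡ proj₂ rv) L → List.map proj₁ L · z ≡ List.map proj₂ L
All⇒equations L z holds = trans (sym (ListP.map-∘ L)) (ListP.map-cong-local holds)

filter-All : ∀ {A : Set} {P R : Pred A 0ℓ} (P? : Decidable P) (xs : List A) →
             All (λ x → P x → R x) xs → All R (List.filter P? xs)
filter-All P? xs P⇒R = All.zipWith (λ (P⇒Rx , Px) → P⇒Rx Px)
                                   (AllP.filter⁺ P? P⇒R , AllP.all-filter P? xs)

-- Every row of A(m) has exactly two nonzero entries: the rows (1 | -e_j)
-- have them in columns 0 and j+1, and the rows (0 | r) inherit them from r.
module _ {m : ℕ} where

  headRow : Fin m → Fin (suc m) → ℤ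
  headRow j zero    = + 1
  headRow j (suc k) = if does (k Fin.≟ j) then ℤ.- (+ 1) else + 0

  shiftRow : (Fin m → ℤ) → Fin (suc m) → ℤ
  shiftRow r zero    = + 0
  shiftRow r (suc k) = r k

  headRow-pair : (j : Fin m) → PairSupport (headRow j)
  headRow-pair j = record
    { col₁ = zero ; col₂ = suc j ; distinct = λ () ; nonzero₁ = λ ()
    ; nonzero₂ = at-j ; vanish = elsewhere }
    where
    at-j : headRow j (suc j) ≢ + 0
    at-j with j Fin.≟ j
    ... | yes _   = λ ()
    ... | no  j≢j = ⊥-elim (j≢j refl)
    elsewhere : ∀ c → c ≢ zero → c ≢ suc j → headRow j c ≡ + 0
    elsewhere zero    c≢0 _     = ⊥-elim (c≢0 refl)
    elsewhere (suc k) _   k≢j with k Fin.≟ j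
    ... | yes k≡j = ⊥-elim (k≢j (cong suc k≡j))
    ... | no  _   = refl

  shiftRow-pair : {r : Fin m → ℤ} → PairSupport r → PairSupport (shiftRow r)
  shiftRow-pair ps = record
    { col₁ = suc (col₁ ps) ; col₂ = suc (col₂ ps)
    ; distinct = distinct ps ∘ FinP.suc-injective
    ; nonzero₁ = nonzero₁ ps ; nonzero₂ = nonzero₂ ps ; vanish = elsewhere }
    where
    elsewhere : ∀ c → c ≢ suc (col₁ ps) → c ≢ suc (col₂ ps) → shiftRow _ c ≡ + 0
    elsewhere zero    _    _    = refl
    elsewhere (suc k) k≢c₁ k≢c₂ = vanish ps k (k≢c₁ ∘ cong suc) (k≢c₂ ∘ cong suc)

Amat-pair : ∀ m → All PairSupport (Amat m)
Amat-pair zero    = []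
Amat-pair (suc m) = AllP.++⁺
  (AllP.tabulate⁺ (λ j → pairSupport-cong (λ { zero → refl ; (suc _) → refl }) (headRow-pair j)))
  (AllP.map⁺ (All.map (pairSupport-cong (λ { zero → refl ; (suc _) → refl }) ∘ shiftRow-pair)
                      (Amat-pair m)))

blockRow : ∀ n → Fin n → (Fin n → ℤ) → Fin (n ℕ.* n) → ℤ
blockRow n b r c = if does (Fin.quotient n c Fin.≟ b) then r (Fin.remainder {n} n c) else + 0

blockRow-pair : ∀ n (b : Fin n) {r : Fin n → ℤ} → PairSupport r → PairSupport (blockRow n b r)
blockRow-pair n b {r} ps = record
  { col₁ = Fin.combine b (col₁ ps) ; col₂ = Fin.combine b (col₂ ps)
  ; distinct = distinct ps ∘ FinP.combine-injectiveʳ b (col₁ ps) b (col₂ ps)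
  ; nonzero₁ = nonzero₁ ps ∘ trans (sym (inside (col₁ ps)))
  ; nonzero₂ = nonzero₂ ps ∘ trans (sym (inside (col₂ ps)))
  ; vanish = elsewhere }
  where
  in-block : ∀ c → Fin.quotient n c ≡ b → blockRow n b r c ≡ r (Fin.remainder {n} n c)
  in-block c q≡b with Fin.quotient n c Fin.≟ b
  ... | yes _   = refl
  ... | no  q≢b = ⊥-elim (q≢b q≡b)
  inside : ∀ k → blockRow n b r (Fin.combine b k) ≡ r k
  inside k = trans (in-block _ (cong proj₁ (FinP.remQuot-combine b k)))
                   (cong r (cong proj₂ (FinP.remQuot-combine b k)))
  elsewhere : ∀ c → c ≢ Fin.combine b (col₁ ps) → c ≢ Fin.combine b (col₂ ps) → blockRow n b r c ≡ + 0
  elsewhere c c≢₁ c≢₂ with Fin.quotient n c Fin.≟ b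
  ... | no  _    = refl
  ... | yes q≡b = vanish ps _ (c≢₁ ∘ combined) (c≢₂ ∘ combined)
    where
    combined : ∀ {k} → Fin.remainder {n} n c ≡ k → c ≡ Fin.combine b k
    combined rem≡k = trans (sym (FinP.combine-remQuot {n} n c)) (cong₂ Fin.combine q≡b rem≡k)

permute-pair : ∀ {N} (π : Permutation′ N) {r : Fin N → ℤ} → PairSupport r →
               PairSupport (λ j → r (π ⟨$⟩ˡ j))
permute-pair π {r} ps = record
  { col₁ = π ⟨$⟩ʳ col₁ ps ; col₂ = π ⟨$⟩ʳ col₂ ps
  ; distinct = λ eq → distinct ps (trans (sym (inverseˡ π)) (trans (cong (π ⟨$⟩ˡ_) eq) (inverseˡ π)))
  ; nonzero₁ = nonzero₁ ps ∘ trans (sym (cong r (inverseˡ π)))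
  ; nonzero₂ = nonzero₂ ps ∘ trans (sym (cong r (inverseˡ π)))
  ; vanish = λ c c≢₁ c≢₂ → vanish ps _ (c≢₁ ∘ moved) (c≢₂ ∘ moved) }
  where
  moved : ∀ {c k} → π ⟨$⟩ˡ c ≡ k → c ≡ π ⟨$⟩ʳ k
  moved eq = trans (sym (inverseʳ π)) (cong (π ⟨$⟩ʳ_) eq)

Aπ-pair : ∀ n (π : Permutation′ (n ℕ.* n)) → All PairSupport (Aπ n π)
Aπ-pair n π = AllP.map⁺ (All.map (λ {r} → permute-pair π {r})
  (AllP.concat⁺ (AllP.map⁺ (AllP.tabulate⁺ (λ b →
     AllP.map⁺ (All.map (λ {r} → blockRow-pair n b {r}) (Amat-pair n)))))))

module Restriction {N p : ℕ} (J : Fin p → Fin N) (J-inj : Injective _≡_ _≡_ J) where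

  -- If r vanishes outside {u, w} and its restriction keeps two nonzero
  -- entries, then u is a column of J (otherwise only w could be kept).
  kept-column : (r : Fin N → ℤ) (u w : Fin N) → (∀ c → c ≢ u → c ≢ w → r c ≡ + 0) →
                2 ≤ nnz (PJ J r) → ∃ λ m → J m ≡ u
  kept-column r u w vanish-r 2≤nnz with FinP.any? (λ m → J m Fin.≟ u)
  ... | yes u∈J = u∈J
  ... | no  u∉J = ⊥-elim (ℕP.<⇒≱ 2≤nnz (nnz≤1 (PJ J r) unique))
    where
    at-w : ∀ l → r (J l) ≢ + 0 → J l ≡ w
    at-w l rJl≢0 with J l Fin.≟ w
    ... | yes Jl≡w = Jl≡w
    ... | no  Jl≢w = ⊥-elim (rJl≢0 (vanish-r (J l) (λ Jl≡u → u∉J (l , Jl≡u)) Jl≢w))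
    unique : ∀ l m → r (J l) ≢ + 0 → r (J m) ≢ + 0 → l ≡ m
    unique l m rJl≢0 rJm≢0 = J-inj (trans (at-w l rJl≢0) (sym (at-w m rJm≢0)))

  dot-restrict-pair : (r : Fin N → ℤ) → PairSupport r → (x : Fin N → ℤ) →
                      2 ≤ nnz (PJ J r) → dot (PJ J r) (x ∘ J) ≡ dot r x
  dot-restrict-pair r ps x 2≤nnz
    with kept-column r (col₁ ps) (col₂ ps) (vanish ps) 2≤nnz
       | kept-column r (col₂ ps) (col₁ ps) (λ c c≢₂ c≢₁ → vanish ps c c≢₁ c≢₂) 2≤nnz
  ... | a , refl | b , refl = begin
    dot (PJ J r) (x ∘ J)              ≡⟨ dot≡sum (PJ J r) (x ∘ J) ⟩
    ℤSum.sum ((λ j → r j * x j) ∘ J)  ≡⟨ ℤSum.sum-restrict-pair J J-inj _ a b (distinct ps ∘ cong J) vanish-rx ⟩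
    ℤSum.sum (λ j → r j * x j)        ≡⟨ dot≡sum r x ⟨
    dot r x                           ∎
    where
    open ≡-Reasoning
    vanish-rx : ∀ j → j ≢ J a → j ≢ J b → r j * x j ≡ + 0
    vanish-rx j j≢a j≢b = cong (_* x j) (vanish ps j j≢a j≢b)

  dot-restrict-unit : (i : Fin N) (x : Fin N → ℤ) →
                      1 ≤ nnz (PJ J (unit i)) → dot (PJ J (unit i)) (x ∘ J) ≡ dot (unit i) x
  dot-restrict-unit i x 1≤nnz with 1≤nnz⇒nonzero (PJ J (unit i)) 1≤nnz
  ... | m , nonzero with unit-nonzero i (J m) nonzero
  ...   | refl = begin
    dot (PJ J (unit i)) (x ∘ J)        ≡⟨ dot≡sum (PJ J (unit i)) (x ∘ J) ⟩
    ℤSum.sum ((λ j → unit i j * x j) ∘ J)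
      ≡⟨ ℤSum.sum-restrict-single J J-inj (λ j → unit i j * x j) m
           (λ j j≢i → cong (_* x j) (unit-vanish i j j≢i)) ⟩
    ℤSum.sum (λ j → unit i j * x j)  ≡⟨ dot≡sum (unit i) x ⟨
    dot (unit i) x                     ∎
    where open ≡-Reasoning

  nonzero-restrict : (M : Matrix N) → All PairSupport M → (x : Fin N → ℤ) →
                     NonZeroAll (M · x) → NonZeroAll (Bmat J M · (x ∘ J))
  nonzero-restrict M pairs x nonzero =
    AllP.map⁺ (filter-All _ (List.map (PJ J) M) (AllP.map⁺ (All.zipWith kept (pairs , AllP.map⁻ nonzero))))
    where
    kept : ∀ {r} → PairSupport r × dot r x ≢ + 0 → 2 ≤ nnz (PJ J r) → dot (PJ J r) (x ∘ J) ≢ + 0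
    kept {r} (ps , rx≢0) 2≤nnz = rx≢0 ∘ trans (sym (dot-restrict-pair r ps x 2≤nnz))

  equations-restrict : ∀ {k} (idx : Fin k → Fin N) (g : Fin k → ℤ) (x : Fin N → ℤ) →
    List.map proj₁ (AeqG idx g) · x ≡ List.map proj₂ (AeqG idx g) →
    List.map proj₁ (BeqG J (AeqG idx g)) · (x ∘ J) ≡ List.map proj₂ (BeqG J (AeqG idx g))
  equations-restrict idx g x givens =
    All⇒equations _ (x ∘ J) (filter-All _ _ (AllP.map⁺ (AllP.tabulate⁺ kept)))
    where
    kept : ∀ l → 1 ≤ nnz (PJ J (unit (idx l))) → dot (PJ J (unit (idx l))) (x ∘ J) ≡ g l
    kept l 1≤nnz = trans (dot-restrict-unit (idx l) x 1≤nnz)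
                         (AllP.tabulate⁻ (equations⇒All (AeqG idx g) x givens) l)

-- With the full base set nothing is deleted: rows with a nonzero entry
-- (two, for inequality rows) survive, so B = M and (B_eq, g') = (A_eq, g).
Bmat-full : ∀ {N} (M : Matrix N) → All (λ r → 2 ≤ nnz r) M → Bmat id M ≡ M
Bmat-full M kept =
  trans (cong (List.filter _) (ListP.map-id M)) (ListP.filter-all (λ r → 2 ℕ.≤? nnz r) kept)

BeqG-full : ∀ {N} (L : List ((Fin N → ℤ) × ℤ)) → All (λ rv → 1 ≤ nnz (proj₁ rv)) L → BeqG id L ≡ L
BeqG-full L kept =
  trans (cong (List.filter _) (ListP.map-id L)) (ListP.filter-all (λ rv → 1 ℕ.≤? nnz (proj₁ rv)) kept)

increasing⇒injective : ∀ {p N} (J : Fin p → Fin N) → StrictlyIncreasing J → Injective _≡_ _≡_ J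
increasing⇒injective J increasing {a} {b} Ja≡Jb with FinP.<-cmp a b
... | tri< a<b _ _ = ⊥-elim (FinP.<-irrefl Ja≡Jb (increasing a b a<b))
... | tri≈ _ a≡b _ = a≡b
... | tri> _ _ b<a = ⊥-elim (FinP.<-irrefl (sym Ja≡Jb) (increasing b a b<a))

module _ (n : ℕ) (π₁ π₂ π₃ : Permutation′ (n ℕ.* n))
         (k : ℕ) (idx : Fin k → Fin (n ℕ.* n)) (g : Fin k → ℤ) where

  full-base-solution : ∀ z → IsReducedSolution n π₁ π₂ π₃ k idx g (n ℕ.* n) id z →
                       IsSolution n π₁ π₂ π₃ k idx g z
  full-base-solution z (range , nz₁ , nz₂ , nz₃ , givens) =
    range , rows π₁ nz₁ , rows π₂ nz₂ , rows π₃ nz₃ ,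
    subst (λ L → List.map proj₁ L · z ≡ List.map proj₂ L) (BeqG-full (AeqG idx g) unit-rows) givens
    where
    rows : ∀ π → NonZeroAll (Bmat id (Aπ n π) · z) → NonZeroAll (Aπ n π · z)
    rows π = subst (λ M → NonZeroAll (M · z)) (Bmat-full (Aπ n π) (All.map 2≤nnz-pair (Aπ-pair n π)))
    unit-rows : All (λ rv → 1 ≤ nnz (proj₁ rv)) (AeqG idx g)
    unit-rows = AllP.tabulate⁺ (λ l → 1≤nnz (unit (idx l)) (idx l) (unit-self (idx l)))

  restricted-solution : ∀ {p} (J : Fin p → Fin (n ℕ.* n)) → Injective _≡_ _≡_ J →
    ∀ x → IsSolution n π₁ π₂ π₃ k idx g x → IsReducedSolution n π₁ π₂ π₃ k idx g p J (x ∘ J)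
  restricted-solution J J-inj x (range , nz₁ , nz₂ , nz₃ , givens) =
    range ∘ J , rows π₁ nz₁ , rows π₂ nz₂ , rows π₃ nz₃ , equations-restrict idx g x givens
    where
    open Restriction J J-inj
    rows : ∀ π → NonZeroAll (Aπ n π · x) → NonZeroAll (Bmat J (Aπ n π) · (x ∘ J))
    rows π = nonzero-restrict (Aπ n π) (Aπ-pair n π) x

theorem5p1 : (n : ℕ) → 2 ℕ.≤ n →
  (π₁ π₂ π₃ : Permutation′ (n ℕ.* n)) →
  (k : ℕ) → (idx : Fin k → Fin (n ℕ.* n)) → Injective _≡_ _≡_ idx →
  (g : Fin k → ℤ) → (∀ l → (+ 1 ℤ.≤ g l) × (g l ℤ.≤ + n)) →
  (i : Fin (n ℕ.* n)) → (v : ℤ) → (+ 1 ℤ.≤ v) × (v ℤ.≤ + n) →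
  UnicityCell n π₁ π₂ π₃ k idx g i v
    ⇔ (Σ[ p ∈ ℕ ] Σ[ J ∈ (Fin p → Fin (n ℕ.* n)) ] StrictlyIncreasing J
        × Σ[ l ∈ Fin p ] (J l ≡ i) × UnicityCellWrt n π₁ π₂ π₃ k idx g p J l v)
theorem5p1 n _ π₁ π₂ π₃ k idx _ g _ i v _ = mk⇔ unique⇒unique-wrt-all unique-wrt⇒unique
  where
  unique⇒unique-wrt-all : UnicityCell n π₁ π₂ π₃ k idx g i v →
    Σ[ p ∈ ℕ ] Σ[ J ∈ (Fin p → Fin (n ℕ.* n)) ] StrictlyIncreasing J
      × Σ[ l ∈ Fin p ] (J l ≡ i) × UnicityCellWrt n π₁ π₂ π₃ k idx g p J l v
  unique⇒unique-wrt-all unique =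
    n ℕ.* n , id , (λ _ _ a<b → a<b) , i , refl ,
    λ z reduced → unique z (full-base-solution n π₁ π₂ π₃ k idx g z reduced)

  unique-wrt⇒unique : (Σ[ p ∈ ℕ ] Σ[ J ∈ (Fin p → Fin (n ℕ.* n)) ] StrictlyIncreasing J
      × Σ[ l ∈ Fin p ] (J l ≡ i) × UnicityCellWrt n π₁ π₂ π₃ k idx g p J l v) →
    UnicityCell n π₁ π₂ π₃ k idx g i v
  unique-wrt⇒unique (p , J , increasing , l , Jl≡i , unique-wrt) x solution =
    subst (λ c → x c ≡ v) Jl≡i
      (unique-wrt (x ∘ J) (restricted-solution n π₁ π₂ π₃ k idx g J J-inj x solution))
    where
    J-inj : Injective _≡_ _≡_ J
    J-inj = increasing⇒injective J increasing
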